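{- The set $$SI=\{x\in\mathbb{N}\mid \text{there exists a total recursive } F:\mathbb{N}\to\mathbb{N} \text{ such that } \forall z\in\mathbb{N},\ \varphi_x(z)\downarrow\implies F(z)\geq\varphi_x(z)\}$$ belongs to $\Sigma^0_3$ in the arithmetical hierarchy.
   Context: Fix an acceptable Gödel numbering of the partial recursive functions: $\varphi_x$ denotes the partial recursive function $\mathbb{N}\to\mathbb{N}$ with Gödel number $x$; $\varphi_x(z)\downarrow$ means $\varphi_x$ is defined on $z$. -}

module Defs where

open import Data.Nat using (ℕ; zero; suc; _<_; _≤_)
open import Data.Fin using (Fin; zero; suc)
open import Data.Vec using (Vec; []; _∷_; lookup; head)
open import Data.Product using (Σ; ∃; _×_; _,_; proj₁; proj₂)
open import Relation.Binary.PropositionalEquality using (_≡_)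
open import Function.Bundles using (_⇔_)

data PR : ℕ → Set where
  Z    : ∀ {n} → PR n
  S    : PR 1
  P    : ∀ {n} → Fin n → PR n
  comp : ∀ {n m} → PR m → Vec (PR n) m → PR n
  rec  : ∀ {n} → PR n → PR (suc (suc n)) → PR (suc n)
  mu   : ∀ {n} → PR (suc n) → PR n

-- Big-step semantics:  f ⇓ v ↦ y  means f(v) converges with value y

mutual
  data _⇓_↦_ : ∀ {n} → PR n → Vec ℕ n → ℕ → Set where
    Z⇓    : ∀ {n} {v : Vec ℕ n} → Z ⇓ v ↦ 0
    S⇓    : ∀ {x} → S ⇓ (x ∷ []) ↦ suc x
    P⇓    : ∀ {n} {i : Fin n} {v} → P i ⇓ v ↦ lookup v i
    comp⇓ : ∀ {n m} {f : PR m} {gs : Vec (PR n) m} {v ws y} →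
            gs ⇓* v ↦ ws → f ⇓ ws ↦ y → comp f gs ⇓ v ↦ y
    rec0⇓ : ∀ {n} {g : PR n} {h} {v y} →
            g ⇓ v ↦ y → rec g h ⇓ (0 ∷ v) ↦ y
    recS⇓ : ∀ {n} {g : PR n} {h} {v k r y} →
            rec g h ⇓ (k ∷ v) ↦ r → h ⇓ (k ∷ r ∷ v) ↦ y →
            rec g h ⇓ (suc k ∷ v) ↦ y
    mu⇓   : ∀ {n} {f : PR (suc n)} {v k} →
            f ⇓ (k ∷ v) ↦ 0 →
            (∀ j → j < k → ∃ λ m → f ⇓ (j ∷ v) ↦ suc m) →
            mu f ⇓ v ↦ k

  data _⇓*_↦_ : ∀ {n m} → Vec (PR n) m → Vec ℕ n → Vec ℕ m → Set where
    []⇓ : ∀ {n} {v : Vec ℕ n} → [] ⇓* v ↦ []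
    ∷⇓  : ∀ {n m} {g : PR n} {gs : Vec (PR n) m} {v y ys} →
          g ⇓ v ↦ y → gs ⇓* v ↦ ys → (g ∷ gs) ⇓* v ↦ (y ∷ ys)

-- Gödel numbering (effective, surjective decoding of codes into terms)

-- Cantor enumeration of ℕ × ℕ : (0,0),(0,1),(1,0),(0,2),(1,1),(2,0),...
next : ℕ × ℕ → ℕ × ℕ
next (a , zero)  = (zero , suc a)
next (a , suc b) = (suc a , b)

unpair : ℕ → ℕ × ℕ
unpair zero    = (zero , zero)
unpair (suc r) = next (unpair r)

clampFin : (k : ℕ) → ℕ → Fin (suc k)
clampFin zero    _       = zero
clampFin (suc k) zero    = zero
clampFin (suc k) (suc i) = suc (clampFin k i)

succAt : (n : ℕ) → PR n
succAt (suc zero) = S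
succAt _          = Z

projAt : (n : ℕ) → ℕ → PR n
projAt zero    _ = Z
projAt (suc k) i = P (clampFin k i)

mutual
  -- decodeF fuel n x : the arity-n term with code x (fuel ≥ x suffices)
  decodeF : ℕ → (n : ℕ) → ℕ → PR n
  decodeF zero       n x = Z
  decodeF (suc fuel) n x = byTag fuel n (proj₁ (unpair x)) (proj₂ (unpair x))

  byTag : ℕ → (n : ℕ) → ℕ → ℕ → PR n
  byTag fuel n 0 r = Z
  byTag fuel n 1 r = succAt n
  byTag fuel n 2 r = projAt n r
  byTag fuel n 3 r =
    comp (decodeF fuel (proj₁ (unpair r)) (proj₁ (unpair (proj₂ (unpair r)))))
         (decodeVec fuel n (proj₁ (unpair r)) (proj₂ (unpair (proj₂ (unpair r)))))
  byTag fuel zero    4 r = Z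
  byTag fuel (suc k) 4 r =
    rec (decodeF fuel k (proj₁ (unpair r))) (decodeF fuel (suc (suc k)) (proj₂ (unpair r)))
  byTag fuel n (suc (suc (suc (suc (suc _))))) r = mu (decodeF fuel (suc n) r)

  decodeVec : ℕ → (n m : ℕ) → ℕ → Vec (PR n) m
  decodeVec fuel n zero    c = []
  decodeVec fuel n (suc m) c =
    decodeF fuel n (proj₁ (unpair c)) ∷ decodeVec fuel n m (proj₂ (unpair c))

decode : ℕ → PR 1
decode x = decodeF x 1 x

φ_⟨_⟩↦_ : ℕ → ℕ → ℕ → Set
φ x ⟨ z ⟩↦ y = decode x ⇓ (z ∷ []) ↦ y

Computable : (n : ℕ) → (Vec ℕ n → ℕ) → Set
Computable n f = Σ (PR n) λ c → ∀ v → c ⇓ v ↦ f v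

TotalRecursive : (ℕ → ℕ) → Set
TotalRecursive F = Computable 1 (λ v → F (head v))

-- Σ⁰₃ : A x ⇔ ∃a ∀b ∃c R(x,a,b,c) with R recursive
-- (R given by a total recursive characteristic function χ, R ≡ (χ = 0))

Σ⁰₃ : (ℕ → Set) → Set
Σ⁰₃ A = Σ (Vec ℕ 4 → ℕ) λ χ → Computable 4 χ ×
        (∀ x → A x ⇔ (∃ λ a → ∀ b → ∃ λ c → χ (x ∷ a ∷ b ∷ c ∷ []) ≡ 0))

SI : ℕ → Set
SI x = ∃ λ (F : ℕ → ℕ) → TotalRecursive F ×
       (∀ z y → φ x ⟨ z ⟩↦ y → y ≤ F z)

-- A convergent computation φ_x(z) = y has a finite derivation in the big-step
-- semantics ⇓. Cut into obligations coded as numbers ("the term with code x maps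
-- input c to y", "these k values are nonzero", ...), such a derivation can be
-- checked by a primitive recursive worklist machine: each step pops an obligation,
-- tests it locally, and pushes the premises it rests on, the intermediate values
-- being read off a certificate. So "φ_x(z) = y" is ∃(d, s) R(x, z, y, d, s) with R
-- recursive, and x ∈ SI iff
--   ∃a ∀(z, y, d, s) ∃(w, e, t): R(a, z, w, e, t) ∧ (R(x, z, y, d, s) → y ≤ w),
-- the bound F being the total function computed by program a; determinism of ⇓
-- makes the w found for z equal to F(z).

module Submission where

open import Defs
open import Data.Nat using (ℕ; zero; suc; _+_; _∸_; _<_; _≤_; z≤n; s≤s; pred; ∣_-_∣)
open import Data.Nat.Properties
open import Data.Nat.GeneralisedArithmetic using (fold; iterate; iterate-is-fold)
open import Data.Fin using (Fin; zero; suc; toℕ)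
open import Data.Vec using (Vec; []; _∷_; lookup; head; tail)
open import Data.Product using (∃; _×_; _,_; proj₁; proj₂)
open import Relation.Binary.PropositionalEquality
open import Data.Empty using (⊥-elim)
open import Data.Sum using (inj₁; inj₂)
open import Relation.Binary.Definitions using (tri<; tri≈; tri>)
open import Function.Base using (_∘_)
open import Function.Bundles using (mk⇔)

-- Cantor pairing

triangle : ℕ → ℕ
triangle zero    = 0
triangle (suc n) = triangle n + suc n

pair : ℕ → ℕ → ℕ
pair a b = triangle (a + b) + a

π₁ π₂ : ℕ → ℕ
π₁ r = proj₁ (unpair r)
π₂ r = proj₂ (unpair r)

pair-next : ∀ a b → pair (proj₁ (next (a , b))) (proj₂ (next (a , b))) ≡ suc (pair a b)
pair-next a zero = begin
  triangle (suc a) + 0    ≡⟨ +-identityʳ _ ⟩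
  triangle a + suc a      ≡⟨ +-suc (triangle a) a ⟩
  suc (triangle a + a)    ≡⟨ cong (λ s → suc (triangle s + a)) (sym (+-identityʳ a)) ⟩
  suc (triangle (a + 0) + a) ∎
  where open ≡-Reasoning
pair-next a (suc b) = begin
  triangle (suc a + b) + suc a    ≡⟨ +-suc _ a ⟩
  suc (triangle (suc a + b) + a)  ≡⟨ cong (λ s → suc (triangle s + a)) (sym (+-suc a b)) ⟩
  suc (triangle (a + suc b) + a)  ∎
  where open ≡-Reasoning

pair-unpair : ∀ r → pair (π₁ r) (π₂ r) ≡ r
pair-unpair zero    = refl
pair-unpair (suc r) = trans (pair-next (π₁ r) (π₂ r)) (cong suc (pair-unpair r))

unpair-surjective : ∀ s a b → a + b ≡ s → ∃ λ r → unpair r ≡ (a , b)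
unpair-surjective _       zero    zero    _  = 0 , refl
unpair-surjective zero    zero    (suc b) ()
unpair-surjective zero    (suc a) b       ()
unpair-surjective (suc s) zero    (suc b) eq
  with r , q ← unpair-surjective s b zero (trans (+-identityʳ b) (suc-injective eq))
  = suc r , cong next q
unpair-surjective (suc s) (suc a) b       eq
  with r , q ← unpair-surjective (suc s) a (suc b) (trans (+-suc a b) eq)
  = suc r , cong next q

unpair-pair : ∀ a b → unpair (pair a b) ≡ (a , b)
unpair-pair a b with r , q ← unpair-surjective (a + b) a b refl =
  trans (cong unpair (trans (cong (λ p → pair (proj₁ p) (proj₂ p)) (sym q)) (pair-unpair r))) q

π₁-pair : ∀ a b → π₁ (pair a b) ≡ a
π₁-pair a b = cong proj₁ (unpair-pair a b)

π₂-pair : ∀ a b → π₂ (pair a b) ≡ b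
π₂-pair a b = cong proj₂ (unpair-pair a b)

pair-β : ∀ {A : Set} (g : ℕ → ℕ → A) a b → g (π₁ (pair a b)) (π₂ (pair a b)) ≡ g a b
pair-β g a b = cong₂ g (π₁-pair a b) (π₂-pair a b)

pair-β₃ : ∀ {A : Set} (g : ℕ → ℕ → ℕ → A) a b c →
          g (π₁ (pair a (pair b c))) (π₁ (π₂ (pair a (pair b c)))) (π₂ (π₂ (pair a (pair b c)))) ≡ g a b c
pair-β₃ g a b c = trans (pair-β (λ a′ p → g a′ (π₁ p) (π₂ p)) a (pair b c)) (pair-β (g a) b c)

ifz : ℕ → ℕ → ℕ → ℕ
ifz zero    a b = a
ifz (suc _) a b = b

-- Unlike unpair, whose recursion carries a pair, diagonal recurses on ℕ alone and so is
-- primitive recursive; π₁ and π₂ are then recovered from it by arithmetic.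
diagonal : ℕ → ℕ
diagonal zero    = 0
diagonal (suc r) = ifz ∣ triangle (suc (diagonal r)) - suc r ∣ (suc (diagonal r)) (diagonal r)

diagonal-suc : ∀ r a b → r ≡ pair a b → diagonal r ≡ a + b →
               diagonal (suc r) ≡ proj₁ (next (a , b)) + proj₂ (next (a , b))
diagonal-suc _ a zero refl ih
  rewrite ih | +-identityʳ a | +-suc (triangle a) a | ∣n-n∣≡0 (suc (triangle a + a)) = refl
diagonal-suc _ a (suc b) refl ih rewrite ih
  with ∣ triangle (a + suc b) + suc (a + suc b) - suc (triangle (a + suc b) + a) ∣ in eq
... | suc _ = +-suc a b
... | zero  = ⊥-elim (m+1+n≢m a (suc-injective (+-cancelˡ-≡ (triangle (a + suc b)) _ _ same)))
  where
  same : triangle (a + suc b) + suc (a + suc b) ≡ triangle (a + suc b) + suc a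
  same = trans (∣m-n∣≡0⇒m≡n eq) (sym (+-suc _ a))

diagonal-unpair : ∀ r → diagonal r ≡ π₁ r + π₂ r
diagonal-unpair zero    = refl
diagonal-unpair (suc r) = diagonal-suc r (π₁ r) (π₂ r) (sym (pair-unpair r)) (diagonal-unpair r)

π₁-via-diagonal : ∀ r → r ∸ triangle (diagonal r) ≡ π₁ r
π₁-via-diagonal r rewrite diagonal-unpair r =
  trans (cong (_∸ triangle (π₁ r + π₂ r)) (sym (pair-unpair r))) (m+n∸m≡n (triangle (π₁ r + π₂ r)) (π₁ r))

π₂-via-diagonal : ∀ r → diagonal r ∸ π₁ r ≡ π₂ r
π₂-via-diagonal r rewrite diagonal-unpair r = m+n∸m≡n (π₁ r) (π₂ r)

toVec : (n : ℕ) → ℕ → Vec ℕ n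
toVec zero    c = []
toVec (suc n) c = π₁ c ∷ toVec n (π₂ c)

fromVec : ∀ {n} → Vec ℕ n → ℕ
fromVec []      = 0
fromVec (a ∷ v) = pair a (fromVec v)

toVec-pair : ∀ n a b → toVec (suc n) (pair a b) ≡ a ∷ toVec n b
toVec-pair n a b rewrite π₁-pair a b | π₂-pair a b = refl

toVec-fromVec : ∀ {n} (v : Vec ℕ n) → toVec n (fromVec v) ≡ v
toVec-fromVec []      = refl
toVec-fromVec (a ∷ v) = trans (toVec-pair _ a (fromVec v)) (cong (a ∷_) (toVec-fromVec v))

computable-resp : ∀ {n} {f g : Vec ℕ n → ℕ} → (∀ v → f v ≡ g v) → Computable n f → Computable n g
computable-resp f≗g (c , c⇓) = c , λ v → subst (c ⇓ v ↦_) (f≗g v) (c⇓ v)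

record Computable₁ (f : ℕ → ℕ) : Set where
  constructor mk₁
  field program₁ : Computable 1 (λ v → f (head v))

record Computable₂ (f : ℕ → ℕ → ℕ) : Set where
  constructor mk₂
  field program₂ : Computable 2 (λ v → f (head v) (head (tail v)))

record Computable₃ (f : ℕ → ℕ → ℕ → ℕ) : Set where
  constructor mk₃
  field program₃ : Computable 3 (λ v → f (head v) (head (tail v)) (head (tail (tail v))))

module _ {n : ℕ} where

  projᶜ : (i : Fin n) → Computable n (λ v → lookup v i)
  projᶜ i = P i , λ v → P⇓

  constᶜ : ∀ k → Computable n (λ _ → k)
  constᶜ zero    = Z , λ v → Z⇓
  constᶜ (suc k) with c , c⇓ ← constᶜ k = comp S (c ∷ []) , λ v → comp⇓ (∷⇓ (c⇓ v) []⇓) S⇓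

  compose₁ : ∀ {f} {g : Vec ℕ n → ℕ} → Computable₁ f → Computable n g →
             Computable n (λ v → f (g v))
  compose₁ {g = g} (mk₁ (cf , cf⇓)) (cg , cg⇓) =
    comp cf (cg ∷ []) , λ v → comp⇓ (∷⇓ (cg⇓ v) []⇓) (cf⇓ (g v ∷ []))

  compose₂ : ∀ {f} {g h : Vec ℕ n → ℕ} → Computable₂ f → Computable n g → Computable n h →
             Computable n (λ v → f (g v) (h v))
  compose₂ {g = g} {h} (mk₂ (cf , cf⇓)) (cg , cg⇓) (ch , ch⇓) =
    comp cf (cg ∷ ch ∷ []) , λ v → comp⇓ (∷⇓ (cg⇓ v) (∷⇓ (ch⇓ v) []⇓)) (cf⇓ (g v ∷ h v ∷ []))

  compose₃ : ∀ {f} {g h k : Vec ℕ n → ℕ} → Computable₃ f →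
             Computable n g → Computable n h → Computable n k →
             Computable n (λ v → f (g v) (h v) (k v))
  compose₃ {g = g} {h} {k} (mk₃ (cf , cf⇓)) (cg , cg⇓) (ch , ch⇓) (ck , ck⇓) =
    comp cf (cg ∷ ch ∷ ck ∷ []) ,
    λ v → comp⇓ (∷⇓ (cg⇓ v) (∷⇓ (ch⇓ v) (∷⇓ (ck⇓ v) []⇓))) (cf⇓ (g v ∷ h v ∷ k v ∷ []))

primrec-computable :
  ∀ {n} {g : Vec ℕ n → ℕ} {h : Vec ℕ (suc (suc n)) → ℕ} (F : ℕ → Vec ℕ n → ℕ) →
  Computable n g → Computable (suc (suc n)) h →
  (∀ v → g v ≡ F 0 v) → (∀ k v → h (k ∷ F k v ∷ v) ≡ F (suc k) v) →
  Computable (suc n) (λ v → F (head v) (tail v))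
primrec-computable F (cg , cg⇓) (ch , ch⇓) F-zero F-suc = rec cg ch , λ { (k ∷ v) → run k v }
  where
  run : ∀ k v → rec cg ch ⇓ (k ∷ v) ↦ F k v
  run zero    v = rec0⇓ (subst (cg ⇓ v ↦_) (F-zero v) (cg⇓ v))
  run (suc k) v = recS⇓ (run k v) (subst (ch ⇓ (k ∷ F k v ∷ v) ↦_) (F-suc k v) (ch⇓ _))

x₀ : ∀ {n} → Fin (suc n)
x₀ = zero

x₁ : ∀ {n} → Fin (suc (suc n))
x₁ = suc zero

x₂ : ∀ {n} → Fin (suc (suc (suc n)))
x₂ = suc x₁

x₃ : ∀ {n} → Fin (suc (suc (suc (suc n))))
x₃ = suc x₂

suc-computable : Computable₁ suc
suc-computable = mk₁ (S , λ { (x ∷ []) → S⇓ })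

pred-computable : Computable₁ pred
pred-computable = mk₁ (computable-resp (λ { (k ∷ []) → refl })
  (primrec-computable {0} (λ k _ → pred k) (constᶜ 0) (projᶜ x₀) (λ _ → refl) (λ _ _ → refl)))

ifz-computable : Computable₃ ifz
ifz-computable = mk₃ (computable-resp (λ { (z ∷ a ∷ b ∷ []) → refl })
  (primrec-computable {2} (λ z v → ifz z (head v) (head (tail v))) (projᶜ x₀) (projᶜ x₃)
    (λ { (a ∷ b ∷ []) → refl }) (λ { k (a ∷ b ∷ []) → refl })))

+-computable : Computable₂ _+_
+-computable = mk₂ (computable-resp (λ { (a ∷ b ∷ []) → refl })
  (primrec-computable {1} (λ a v → a + head v) (projᶜ x₀) (compose₁ suc-computable (projᶜ x₁))
    (λ { (b ∷ []) → refl }) (λ { k (b ∷ []) → refl })))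

∸-computable : Computable₂ _∸_
∸-computable = mk₂ (computable-resp (λ { (a ∷ b ∷ []) → refl })
  (compose₂ (mk₂ flipped) (projᶜ x₁) (projᶜ x₀)))
  where
  flipped : Computable 2 (λ v → head (tail v) ∸ head v)
  flipped = primrec-computable {1} (λ b v → head v ∸ b) (projᶜ x₀)
    (compose₁ pred-computable (projᶜ x₁))
    (λ { (a ∷ []) → refl }) (λ { k (a ∷ []) → pred[m∸n]≡m∸[1+n] a k })

∣m-n∣≡[m∸n]+[n∸m] : ∀ m n → ∣ m - n ∣ ≡ (m ∸ n) + (n ∸ m)
∣m-n∣≡[m∸n]+[n∸m] zero    zero    = refl
∣m-n∣≡[m∸n]+[n∸m] zero    (suc n) = refl
∣m-n∣≡[m∸n]+[n∸m] (suc m) zero    = sym (+-identityʳ (suc m))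
∣m-n∣≡[m∸n]+[n∸m] (suc m) (suc n) = ∣m-n∣≡[m∸n]+[n∸m] m n

-- fooᶜ lifts the computability of foo to arguments that are computable functions of n inputs.
module _ {n : ℕ} where

  private
    Cm : (Vec ℕ n → ℕ) → Set
    Cm = Computable n

  sucᶜ : ∀ {a} → Cm a → Cm (λ v → suc (a v))
  sucᶜ = compose₁ suc-computable

  predᶜ : ∀ {a} → Cm a → Cm (λ v → pred (a v))
  predᶜ = compose₁ pred-computable

  ifzᶜ : ∀ {a b c} → Cm a → Cm b → Cm c → Cm (λ v → ifz (a v) (b v) (c v))
  ifzᶜ = compose₃ ifz-computable

  _+ᶜ_ : ∀ {a b} → Cm a → Cm b → Cm (λ v → a v + b v)
  _+ᶜ_ = compose₂ +-computable

  _∸ᶜ_ : ∀ {a b} → Cm a → Cm b → Cm (λ v → a v ∸ b v)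
  _∸ᶜ_ = compose₂ ∸-computable

  ∣_-_∣ᶜ : ∀ {a b} → Cm a → Cm b → Cm (λ v → ∣ a v - b v ∣)
  ∣_-_∣ᶜ {a} {b} ca cb =
    computable-resp (λ v → sym (∣m-n∣≡[m∸n]+[n∸m] (a v) (b v))) ((ca ∸ᶜ cb) +ᶜ (cb ∸ᶜ ca))

triangle-computable : Computable₁ triangle
triangle-computable = mk₁ (computable-resp (λ { (k ∷ []) → refl })
  (primrec-computable {0} (λ k _ → triangle k) (constᶜ 0) (projᶜ x₁ +ᶜ sucᶜ (projᶜ x₀))
    (λ _ → refl) (λ _ _ → refl)))

diagonal-computable : Computable₁ diagonal
diagonal-computable = mk₁ (computable-resp (λ { (k ∷ []) → refl })
  (primrec-computable {0} (λ k _ → diagonal k) (constᶜ 0)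
    (ifzᶜ ∣ compose₁ triangle-computable (sucᶜ (projᶜ x₁)) - sucᶜ (projᶜ x₀) ∣ᶜ
          (sucᶜ (projᶜ x₁)) (projᶜ x₁))
    (λ _ → refl) (λ _ _ → refl)))

π₁-computable : Computable₁ π₁
π₁-computable = mk₁ (computable-resp (λ { (r ∷ []) → π₁-via-diagonal r })
  (projᶜ x₀ ∸ᶜ compose₁ triangle-computable (compose₁ diagonal-computable (projᶜ x₀))))

π₂-computable : Computable₁ π₂
π₂-computable = mk₁ (computable-resp (λ { (r ∷ []) → π₂-via-diagonal r })
  (compose₁ diagonal-computable (projᶜ x₀) ∸ᶜ compose₁ π₁-computable (projᶜ x₀)))

pair-computable : Computable₂ pair
pair-computable = mk₂ (computable-resp (λ { (a ∷ b ∷ []) → refl })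
  (compose₁ triangle-computable (projᶜ x₀ +ᶜ projᶜ x₁) +ᶜ projᶜ x₀))

fold-computable : ∀ {f} → Computable₁ f → Computable₂ (λ k s → fold s f k)
fold-computable {f} cf = mk₂ (computable-resp (λ { (k ∷ s ∷ []) → refl })
  (primrec-computable {1} (λ k v → fold (head v) f k) (projᶜ x₀) (compose₁ cf (projᶜ x₁))
    (λ { (s ∷ []) → refl }) (λ { k (s ∷ []) → refl })))

-- The verifier

accept : ℕ → ℕ → ℕ
accept b rest = ifz b (suc rest) 0

cons : ℕ → ℕ → ℕ
cons i l = suc (pair i l)

-- Items are obligations pair tag fields, whose meaning Holds is defined below; a
-- field d is a certificate supplying intermediate values of the derivation, and f is
-- the fuel passed to decodeF.
evalItem : (f n x c y d : ℕ) → ℕ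
evalItem f n x c y d = pair 0 (fromVec (f ∷ n ∷ x ∷ c ∷ y ∷ d ∷ []))

evalsItem : (f n m g c w d : ℕ) → ℕ
evalsItem f n m g c w d = pair 1 (fromVec (f ∷ n ∷ m ∷ g ∷ c ∷ w ∷ d ∷ []))

positiveItem : (f n r c k d : ℕ) → ℕ
positiveItem f n r c k d = pair 2 (fromVec (f ∷ n ∷ r ∷ c ∷ k ∷ d ∷ []))

lookupItem : (k c i y : ℕ) → ℕ
lookupItem k c i y = pair 3 (fromVec (k ∷ c ∷ i ∷ y ∷ []))

checkRec : (f n x r a c y d rest : ℕ) → ℕ
checkRec f n x r a c y d rest =
  ifz a (suc (cons (evalItem f (pred n) (π₁ r) c y d) rest))
        (suc (cons (evalItem (suc f) n x (pair (pred a) c) (π₁ d) (π₁ (π₂ d)))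
             (cons (evalItem f (suc n) (π₂ r) (pair (pred a) (pair (π₁ d) c)) y (π₂ (π₂ d)))
                   rest)))

-- Follows byTag clause by clause, including its junk cases (arity mismatches decode to Z).
checkTerm : (f n x t r c y d rest : ℕ) → ℕ
checkTerm f n x t r c y d rest =
  ifz t (accept y rest)
  (ifz (pred t) (ifz ∣ n - 1 ∣ (accept ∣ y - suc (π₁ c) ∣ rest) (accept y rest))
  (ifz (pred (pred t)) (ifz n (accept y rest) (suc (cons (lookupItem (pred n) c r y) rest)))
  (ifz (pred (pred (pred t)))
    (suc (cons (evalItem f (π₁ r) (π₁ (π₂ r)) (π₁ d) y (π₁ (π₂ d)))
         (cons (evalsItem f n (π₁ r) (π₂ (π₂ r)) c (π₁ d) (π₂ (π₂ d))) rest)))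
  (ifz (pred (pred (pred (pred t))))
    (ifz n (accept y rest) (checkRec f n x r (π₁ c) (π₂ c) y d rest))
    (suc (cons (evalItem f (suc n) r (pair y c) 0 (π₁ d))
         (cons (positiveItem f n r c y (π₂ d)) rest)))))))

checkEval : Vec ℕ 6 → ℕ → ℕ
checkEval (f ∷ n ∷ x ∷ c ∷ y ∷ d ∷ []) rest =
  ifz f (accept y rest) (checkTerm (pred f) n x (π₁ x) (π₂ x) c y d rest)

checkEvals : Vec ℕ 7 → ℕ → ℕ
checkEvals (f ∷ n ∷ m ∷ g ∷ c ∷ w ∷ d ∷ []) rest =
  ifz m (suc rest)
    (suc (cons (evalItem f n (π₁ g) c (π₁ w) (π₁ d))
         (cons (evalsItem f n (pred m) (π₂ g) c (π₂ w) (π₂ d)) rest)))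

checkPositive : Vec ℕ 6 → ℕ → ℕ
checkPositive (f ∷ n ∷ r ∷ c ∷ k ∷ d ∷ []) rest =
  ifz k (suc rest)
    (suc (cons (evalItem f (suc n) r (pair (pred k) c) (suc (π₁ d)) (π₁ (π₂ d)))
         (cons (positiveItem f n r c (pred k) (π₂ (π₂ d))) rest)))

checkLookup : Vec ℕ 4 → ℕ → ℕ
checkLookup (k ∷ c ∷ i ∷ y ∷ []) rest =
  ifz k (accept ∣ y - π₁ c ∣ rest)
    (ifz i (accept ∣ y - π₁ c ∣ rest) (suc (cons (lookupItem (pred k) (π₂ c) (pred i) y) rest)))

check : (t p rest : ℕ) → ℕ
check t p rest =
  ifz t (checkEval (toVec 6 p) rest)
  (ifz (pred t) (checkEvals (toVec 7 p) rest)
  (ifz (pred (pred t)) (checkPositive (toVec 6 p) rest) (checkLookup (toVec 4 p) rest)))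

-- A state is 0 (rejected) or suc l for a stack l, where a stack is 0 (empty) or cons i l;
-- state 1 means accepted.
step : ℕ → ℕ
step s = ifz s 0 (ifz (pred s) 1 (check (π₁ (π₁ l)) (π₂ (π₁ l)) (π₂ l)))
  where l = pred (pred s)

initial : (a z w e : ℕ) → ℕ
initial a z w e = suc (cons (evalItem a 1 a (fromVec (z ∷ [])) w e) 0)

verdict : (a z w e t : ℕ) → ℕ
verdict a z w e t = ∣ fold (initial a z w e) step t - 1 ∣

boundedBy : ℕ → ℕ → Vec ℕ 4 → Vec ℕ 3 → ℕ
boundedBy x a (z ∷ y ∷ d ∷ s ∷ []) (w ∷ e ∷ t ∷ []) =
  ifz (verdict a z w e t) (ifz (verdict x z y d s) (y ∸ w) 0) 1

χ : Vec ℕ 4 → ℕ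
χ (x ∷ a ∷ b ∷ c ∷ []) = boundedBy x a (toVec 4 b) (toVec 3 c)

module _ {n : ℕ} where

  private
    Cm : (Vec ℕ n → ℕ) → Set
    Cm = Computable n

  π₁ᶜ : ∀ {a} → Cm a → Cm (λ v → π₁ (a v))
  π₁ᶜ = compose₁ π₁-computable

  π₂ᶜ : ∀ {a} → Cm a → Cm (λ v → π₂ (a v))
  π₂ᶜ = compose₁ π₂-computable

  pairᶜ : ∀ {a b} → Cm a → Cm b → Cm (λ v → pair (a v) (b v))
  pairᶜ = compose₂ pair-computable

  acceptᶜ : ∀ {b rest} → Cm b → Cm rest → Cm (λ v → accept (b v) (rest v))
  acceptᶜ b rest = ifzᶜ b (sucᶜ rest) (constᶜ 0)

  consᶜ : ∀ {i l} → Cm i → Cm l → Cm (λ v → cons (i v) (l v))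
  consᶜ i l = sucᶜ (pairᶜ i l)

  evalItemᶜ : ∀ {f n x c y d} → Cm f → Cm n → Cm x → Cm c → Cm y → Cm d →
              Cm (λ v → evalItem (f v) (n v) (x v) (c v) (y v) (d v))
  evalItemᶜ f n x c y d =
    pairᶜ (constᶜ 0) (pairᶜ f (pairᶜ n (pairᶜ x (pairᶜ c (pairᶜ y (pairᶜ d (constᶜ 0)))))))

  evalsItemᶜ : ∀ {f n m g c w d} → Cm f → Cm n → Cm m → Cm g → Cm c → Cm w → Cm d →
               Cm (λ v → evalsItem (f v) (n v) (m v) (g v) (c v) (w v) (d v))
  evalsItemᶜ f n m g c w d =
    pairᶜ (constᶜ 1) (pairᶜ f (pairᶜ n (pairᶜ m (pairᶜ g (pairᶜ c (pairᶜ w (pairᶜ d (constᶜ 0))))))))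

  positiveItemᶜ : ∀ {f n r c k d} → Cm f → Cm n → Cm r → Cm c → Cm k → Cm d →
                  Cm (λ v → positiveItem (f v) (n v) (r v) (c v) (k v) (d v))
  positiveItemᶜ f n r c k d =
    pairᶜ (constᶜ 2) (pairᶜ f (pairᶜ n (pairᶜ r (pairᶜ c (pairᶜ k (pairᶜ d (constᶜ 0)))))))

  lookupItemᶜ : ∀ {k c i y} → Cm k → Cm c → Cm i → Cm y →
                Cm (λ v → lookupItem (k v) (c v) (i v) (y v))
  lookupItemᶜ k c i y = pairᶜ (constᶜ 3) (pairᶜ k (pairᶜ c (pairᶜ i (pairᶜ y (constᶜ 0)))))

  checkRecᶜ : ∀ {f n x r a c y d rest} →
              Cm f → Cm n → Cm x → Cm r → Cm a → Cm c → Cm y → Cm d → Cm rest →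
              Cm (λ v → checkRec (f v) (n v) (x v) (r v) (a v) (c v) (y v) (d v) (rest v))
  checkRecᶜ f n x r a c y d rest =
    ifzᶜ a (sucᶜ (consᶜ (evalItemᶜ f (predᶜ n) (π₁ᶜ r) c y d) rest))
           (sucᶜ (consᶜ (evalItemᶜ (sucᶜ f) n x (pairᶜ (predᶜ a) c) (π₁ᶜ d) (π₁ᶜ (π₂ᶜ d)))
                 (consᶜ (evalItemᶜ f (sucᶜ n) (π₂ᶜ r) (pairᶜ (predᶜ a) (pairᶜ (π₁ᶜ d) c)) y
                                   (π₂ᶜ (π₂ᶜ d)))
                        rest)))

  checkTermᶜ : ∀ {f n x t r c y d rest} →
               Cm f → Cm n → Cm x → Cm t → Cm r → Cm c → Cm y → Cm d → Cm rest →
               Cm (λ v → checkTerm (f v) (n v) (x v) (t v) (r v) (c v) (y v) (d v) (rest v))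
  checkTermᶜ f n x t r c y d rest =
    ifzᶜ t (acceptᶜ y rest)
    (ifzᶜ (predᶜ t) (ifzᶜ ∣ n - constᶜ 1 ∣ᶜ (acceptᶜ ∣ y - sucᶜ (π₁ᶜ c) ∣ᶜ rest) (acceptᶜ y rest))
    (ifzᶜ (predᶜ (predᶜ t))
      (ifzᶜ n (acceptᶜ y rest) (sucᶜ (consᶜ (lookupItemᶜ (predᶜ n) c r y) rest)))
    (ifzᶜ (predᶜ (predᶜ (predᶜ t)))
      (sucᶜ (consᶜ (evalItemᶜ f (π₁ᶜ r) (π₁ᶜ (π₂ᶜ r)) (π₁ᶜ d) y (π₁ᶜ (π₂ᶜ d)))
            (consᶜ (evalsItemᶜ f n (π₁ᶜ r) (π₂ᶜ (π₂ᶜ r)) c (π₁ᶜ d) (π₂ᶜ (π₂ᶜ d))) rest)))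
    (ifzᶜ (predᶜ (predᶜ (predᶜ (predᶜ t))))
      (ifzᶜ n (acceptᶜ y rest) (checkRecᶜ f n x r (π₁ᶜ c) (π₂ᶜ c) y d rest))
      (sucᶜ (consᶜ (evalItemᶜ f (sucᶜ n) r (pairᶜ y c) (constᶜ 0) (π₁ᶜ d))
            (consᶜ (positiveItemᶜ f n r c y (π₂ᶜ d)) rest)))))))

  checkᶜ : ∀ {t p rest} → Cm t → Cm p → Cm rest → Cm (λ v → check (t v) (p v) (rest v))
  checkᶜ t p rest =
    ifzᶜ t checkEvalᶜ (ifzᶜ (predᶜ t) checkEvalsᶜ (ifzᶜ (predᶜ (predᶜ t)) checkPositiveᶜ checkLookupᶜ))
    where
    field₀ = π₁ᶜ p
    field₁ = π₁ᶜ (π₂ᶜ p)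
    field₂ = π₁ᶜ (π₂ᶜ (π₂ᶜ p))
    field₃ = π₁ᶜ (π₂ᶜ (π₂ᶜ (π₂ᶜ p)))
    field₄ = π₁ᶜ (π₂ᶜ (π₂ᶜ (π₂ᶜ (π₂ᶜ p))))
    field₅ = π₁ᶜ (π₂ᶜ (π₂ᶜ (π₂ᶜ (π₂ᶜ (π₂ᶜ p)))))
    field₆ = π₁ᶜ (π₂ᶜ (π₂ᶜ (π₂ᶜ (π₂ᶜ (π₂ᶜ (π₂ᶜ p))))))
    checkEvalᶜ =
      ifzᶜ field₀ (acceptᶜ field₄ rest)
        (checkTermᶜ (predᶜ field₀) field₁ field₂ (π₁ᶜ field₂) (π₂ᶜ field₂) field₃ field₄ field₅ rest)
    checkEvalsᶜ =
      ifzᶜ field₂ (sucᶜ rest)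
        (sucᶜ (consᶜ (evalItemᶜ field₀ field₁ (π₁ᶜ field₃) field₄ (π₁ᶜ field₅) (π₁ᶜ field₆))
              (consᶜ (evalsItemᶜ field₀ field₁ (predᶜ field₂) (π₂ᶜ field₃) field₄ (π₂ᶜ field₅)
                                 (π₂ᶜ field₆))
                     rest)))
    checkPositiveᶜ =
      ifzᶜ field₄ (sucᶜ rest)
        (sucᶜ (consᶜ (evalItemᶜ field₀ (sucᶜ field₁) field₂ (pairᶜ (predᶜ field₄) field₃)
                                (sucᶜ (π₁ᶜ field₅)) (π₁ᶜ (π₂ᶜ field₅)))
              (consᶜ (positiveItemᶜ field₀ field₁ field₂ field₃ (predᶜ field₄) (π₂ᶜ (π₂ᶜ field₅)))
                     rest)))
    checkLookupᶜ =
      ifzᶜ field₀ (acceptᶜ ∣ field₃ - π₁ᶜ field₁ ∣ᶜ rest)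
        (ifzᶜ field₂ (acceptᶜ ∣ field₃ - π₁ᶜ field₁ ∣ᶜ rest)
          (sucᶜ (consᶜ (lookupItemᶜ (predᶜ field₀) (π₂ᶜ field₁) (predᶜ field₂) field₃) rest)))

step-computable : Computable₁ step
step-computable = mk₁ (computable-resp (λ { (s ∷ []) → refl })
  (ifzᶜ s (constᶜ 0) (ifzᶜ (predᶜ s) (constᶜ 1)
    (checkᶜ (π₁ᶜ (π₁ᶜ stack)) (π₂ᶜ (π₁ᶜ stack)) (π₂ᶜ stack)))))
  where
  s = projᶜ x₀
  stack = predᶜ (predᶜ s)

χ-computable : Computable 4 χ
χ-computable = computable-resp (λ { (x ∷ a ∷ b ∷ c ∷ []) → refl })
  (ifzᶜ (verdictᶜ a z w e t) (ifzᶜ (verdictᶜ x z y d s) (y ∸ᶜ w) (constᶜ 0)) (constᶜ 1))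
  where
  x = projᶜ x₀
  a = projᶜ x₁
  b = projᶜ x₂
  c = projᶜ x₃
  z = π₁ᶜ b
  y = π₁ᶜ (π₂ᶜ b)
  d = π₁ᶜ (π₂ᶜ (π₂ᶜ b))
  s = π₁ᶜ (π₂ᶜ (π₂ᶜ (π₂ᶜ b)))
  w = π₁ᶜ c
  e = π₁ᶜ (π₂ᶜ c)
  t = π₁ᶜ (π₂ᶜ (π₂ᶜ c))
  verdictᶜ : ∀ {a z w e t} → Computable 4 a → Computable 4 z → Computable 4 w →
             Computable 4 e → Computable 4 t →
             Computable 4 (λ v → verdict (a v) (z v) (w v) (e v) (t v))
  verdictᶜ a z w e t =
    ∣ compose₂ (fold-computable step-computable) t
        (sucᶜ (consᶜ (evalItemᶜ a (constᶜ 1) a (pairᶜ z (constᶜ 0)) w e) (constᶜ 0)))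
      - constᶜ 1 ∣ᶜ

-- Soundness of the verifier

byTag-mu : ∀ f n t r → byTag f n (suc (suc (suc (suc (suc t))))) r ≡ mu (decodeF f (suc n) r)
byTag-mu f zero    t r = refl
byTag-mu f (suc n) t r = refl

EvalHolds : Vec ℕ 6 → Set
EvalHolds (f ∷ n ∷ x ∷ c ∷ y ∷ _ ∷ []) = decodeF f n x ⇓ toVec n c ↦ y

EvalsHold : Vec ℕ 7 → Set
EvalsHold (f ∷ n ∷ m ∷ g ∷ c ∷ w ∷ _ ∷ []) = decodeVec f n m g ⇓* toVec n c ↦ toVec m w

PositiveHolds : Vec ℕ 6 → Set
PositiveHolds (f ∷ n ∷ r ∷ c ∷ k ∷ _ ∷ []) =
  ∀ j → j < k → ∃ λ m → decodeF f (suc n) r ⇓ (j ∷ toVec n c) ↦ suc m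

LookupHolds : Vec ℕ 4 → Set
LookupHolds (k ∷ c ∷ i ∷ y ∷ []) = lookup (toVec (suc k) c) (clampFin k i) ≡ y

Holds : ℕ → ℕ → Set
Holds 0                   p = EvalHolds (toVec 6 p)
Holds 1                   p = EvalsHold (toVec 7 p)
Holds 2                   p = PositiveHolds (toVec 6 p)
Holds (suc (suc (suc _))) p = LookupHolds (toVec 4 p)

Valid : ℕ → Set
Valid i = Holds (π₁ i) (π₂ i)

valid-pair : ∀ t p → Valid (pair t p) → Holds t p
valid-pair t p = subst₂ Holds (π₁-pair t p) (π₂-pair t p)

evalItem-valid : ∀ f n x c y d → Valid (evalItem f n x c y d) → decodeF f n x ⇓ toVec n c ↦ y
evalItem-valid f n x c y d =
  subst EvalHolds (toVec-fromVec (f ∷ n ∷ x ∷ c ∷ y ∷ d ∷ []))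
  ∘ valid-pair 0 (fromVec (f ∷ n ∷ x ∷ c ∷ y ∷ d ∷ []))

evalItem-valid-∷ : ∀ f n x a c y d → Valid (evalItem f (suc n) x (pair a c) y d) →
                   decodeF f (suc n) x ⇓ (a ∷ toVec n c) ↦ y
evalItem-valid-∷ f n x a c y d =
  subst (λ v → decodeF f (suc n) x ⇓ v ↦ y) (toVec-pair n a c) ∘ evalItem-valid f (suc n) x (pair a c) y d

evalsItem-valid : ∀ f n m g c w d → Valid (evalsItem f n m g c w d) →
                  decodeVec f n m g ⇓* toVec n c ↦ toVec m w
evalsItem-valid f n m g c w d =
  subst EvalsHold (toVec-fromVec (f ∷ n ∷ m ∷ g ∷ c ∷ w ∷ d ∷ []))
  ∘ valid-pair 1 (fromVec (f ∷ n ∷ m ∷ g ∷ c ∷ w ∷ d ∷ []))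

positiveItem-valid : ∀ f n r c k d → Valid (positiveItem f n r c k d) →
                     ∀ j → j < k → ∃ λ m → decodeF f (suc n) r ⇓ (j ∷ toVec n c) ↦ suc m
positiveItem-valid f n r c k d =
  subst PositiveHolds (toVec-fromVec (f ∷ n ∷ r ∷ c ∷ k ∷ d ∷ []))
  ∘ valid-pair 2 (fromVec (f ∷ n ∷ r ∷ c ∷ k ∷ d ∷ []))

lookupItem-valid : ∀ k c i y → Valid (lookupItem k c i y) →
                   lookup (toVec (suc k) c) (clampFin k i) ≡ y
lookupItem-valid k c i y =
  subst LookupHolds (toVec-fromVec (k ∷ c ∷ i ∷ y ∷ [])) ∘ valid-pair 3 (fromVec (k ∷ c ∷ i ∷ y ∷ []))

data _∈ˢ_ : ℕ → ℕ → Set where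
  here  : ∀ {p} → π₁ p ∈ˢ suc p
  there : ∀ {i p} → i ∈ˢ π₂ p → i ∈ˢ suc p

AllValid : ℕ → Set
AllValid l = ∀ {i} → i ∈ˢ l → Valid i

allValid-cons : ∀ i l → AllValid (cons i l) → Valid i × AllValid l
allValid-cons i l valid =
  subst Valid (π₁-pair i l) (valid here) ,
  λ i∈l → valid (there (subst (_ ∈ˢ_) (sym (π₂-pair i l)) i∈l))

Accepts : ℕ → ℕ → Set
Accepts k s = iterate step s k ≡ 1

iterate-step-0 : ∀ k → iterate step 0 k ≡ 0
iterate-step-0 zero    = refl
iterate-step-0 (suc k) = iterate-step-0 k

Sound : ℕ → Set
Sound k = ∀ l → Accepts k (suc l) → AllValid l

module _ {k : ℕ} (ih : Sound k) where

  accept-sound : ∀ b rest → Accepts k (accept b rest) → b ≡ 0 × AllValid rest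
  accept-sound zero    rest acc = refl , ih rest acc
  accept-sound (suc b) rest acc = ⊥-elim (0≢1+n (trans (sym (iterate-step-0 k)) acc))

  push₁-sound : ∀ A rest → Accepts k (suc (cons A rest)) → Valid A × AllValid rest
  push₁-sound A rest acc = allValid-cons A rest (ih _ acc)

  push₂-sound : ∀ A B rest → Accepts k (suc (cons A (cons B rest))) →
                Valid A × Valid B × AllValid rest
  push₂-sound A B rest acc with valid-A , valid-B∷rest ← allValid-cons A _ (ih _ acc) =
    valid-A , allValid-cons B rest valid-B∷rest

  checkRec-sound :
    ∀ f n x r a c y d rest → π₁ x ≡ 4 → π₂ x ≡ r →
    Accepts k (checkRec f (suc n) x r a c y d rest) →
    rec (decodeF f n (π₁ r)) (decodeF f (suc (suc n)) (π₂ r)) ⇓ (a ∷ toVec n c) ↦ y × AllValid rest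
  checkRec-sound f n x r zero c y d rest _ _ acc
    with valid-g , valid-rest ← push₁-sound (evalItem f n (π₁ r) c y d) rest acc =
    rec0⇓ (evalItem-valid f n (π₁ r) c y d valid-g) , valid-rest
  checkRec-sound f n x r (suc a) c y d rest x-tag x-payload acc
    with valid-rec , valid-h , valid-rest ←
           push₂-sound (evalItem (suc f) (suc n) x (pair a c) (π₁ d) (π₁ (π₂ d)))
                       (evalItem f (suc (suc n)) (π₂ r) (pair a (pair (π₁ d) c)) y (π₂ (π₂ d)))
                       rest acc =
    recS⇓ (subst₂ (λ t r → byTag f (suc n) t r ⇓ (a ∷ toVec n c) ↦ π₁ d) x-tag x-payload
                  (evalItem-valid-∷ (suc f) n x a c (π₁ d) (π₁ (π₂ d)) valid-rec))
          (subst (λ v → decodeF f (suc (suc n)) (π₂ r) ⇓ (a ∷ v) ↦ y) (toVec-pair n (π₁ d) c)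
                 (evalItem-valid-∷ f (suc n) (π₂ r) a (pair (π₁ d) c) y (π₂ (π₂ d)) valid-h)) ,
    valid-rest

  checkTerm-sound :
    ∀ f n x t r c y d rest → π₁ x ≡ t → π₂ x ≡ r →
    Accepts k (checkTerm f n x t r c y d rest) → byTag f n t r ⇓ toVec n c ↦ y × AllValid rest
  checkTerm-sound f n x 0 r c y d rest _ _ acc
    with refl , valid-rest ← accept-sound y rest acc = Z⇓ , valid-rest
  checkTerm-sound f 0 x 1 r c y d rest _ _ acc
    with refl , valid-rest ← accept-sound y rest acc = Z⇓ , valid-rest
  checkTerm-sound f 1 x 1 r c y d rest _ _ acc
    with y-check , valid-rest ← accept-sound ∣ y - suc (π₁ c) ∣ rest acc
    rewrite ∣m-n∣≡0⇒m≡n {y} y-check = S⇓ , valid-rest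
  checkTerm-sound f (suc (suc n)) x 1 r c y d rest _ _ acc
    with refl , valid-rest ← accept-sound y rest acc = Z⇓ , valid-rest
  checkTerm-sound f 0 x 2 r c y d rest _ _ acc
    with refl , valid-rest ← accept-sound y rest acc = Z⇓ , valid-rest
  checkTerm-sound f (suc n) x 2 r c y d rest _ _ acc
    with valid-lookup , valid-rest ← push₁-sound (lookupItem n c r y) rest acc =
    subst (P (clampFin n r) ⇓ toVec (suc n) c ↦_) (lookupItem-valid n c r y valid-lookup) P⇓ ,
    valid-rest
  checkTerm-sound f n x 3 r c y d rest _ _ acc
    with valid-f , valid-gs , valid-rest ←
           push₂-sound (evalItem f (π₁ r) (π₁ (π₂ r)) (π₁ d) y (π₁ (π₂ d)))
                       (evalsItem f n (π₁ r) (π₂ (π₂ r)) c (π₁ d) (π₂ (π₂ d))) rest acc =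
    comp⇓ (evalsItem-valid f n (π₁ r) (π₂ (π₂ r)) c (π₁ d) (π₂ (π₂ d)) valid-gs)
          (evalItem-valid f (π₁ r) (π₁ (π₂ r)) (π₁ d) y (π₁ (π₂ d)) valid-f) ,
    valid-rest
  checkTerm-sound f 0 x 4 r c y d rest _ _ acc
    with refl , valid-rest ← accept-sound y rest acc = Z⇓ , valid-rest
  checkTerm-sound f (suc n) x 4 r c y d rest x-tag x-payload acc =
    checkRec-sound f n x r (π₁ c) (π₂ c) y d rest x-tag x-payload acc
  checkTerm-sound f n x (suc (suc (suc (suc (suc t))))) r c y d rest _ _ acc
    with valid-zero , valid-below , valid-rest ←
           push₂-sound (evalItem f (suc n) r (pair y c) 0 (π₁ d)) (positiveItem f n r c y (π₂ d))
                       rest acc =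
    subst (_⇓ toVec n c ↦ y) (sym (byTag-mu f n t r))
      (mu⇓ (evalItem-valid-∷ f n r y c 0 (π₁ d) valid-zero)
           (positiveItem-valid f n r c y (π₂ d) valid-below)) ,
    valid-rest

  checkEval-sound : ∀ fs rest → Accepts k (checkEval fs rest) → EvalHolds fs × AllValid rest
  checkEval-sound (zero ∷ n ∷ x ∷ c ∷ y ∷ d ∷ []) rest acc
    with refl , valid-rest ← accept-sound y rest acc = Z⇓ , valid-rest
  checkEval-sound (suc f ∷ n ∷ x ∷ c ∷ y ∷ d ∷ []) rest acc =
    checkTerm-sound f n x (π₁ x) (π₂ x) c y d rest refl refl acc

  checkEvals-sound : ∀ fs rest → Accepts k (checkEvals fs rest) → EvalsHold fs × AllValid rest
  checkEvals-sound (f ∷ n ∷ zero ∷ g ∷ c ∷ w ∷ d ∷ []) rest acc = []⇓ , ih rest acc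
  checkEvals-sound (f ∷ n ∷ suc m ∷ g ∷ c ∷ w ∷ d ∷ []) rest acc
    with valid-g , valid-gs , valid-rest ←
           push₂-sound (evalItem f n (π₁ g) c (π₁ w) (π₁ d))
                       (evalsItem f n m (π₂ g) c (π₂ w) (π₂ d)) rest acc =
    ∷⇓ (evalItem-valid f n (π₁ g) c (π₁ w) (π₁ d) valid-g)
       (evalsItem-valid f n m (π₂ g) c (π₂ w) (π₂ d) valid-gs) ,
    valid-rest

  checkPositive-sound : ∀ fs rest → Accepts k (checkPositive fs rest) → PositiveHolds fs × AllValid rest
  checkPositive-sound (f ∷ n ∷ r ∷ c ∷ zero ∷ d ∷ []) rest acc = (λ j ()) , ih rest acc
  checkPositive-sound (f ∷ n ∷ r ∷ c ∷ suc m ∷ d ∷ []) rest acc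
    with valid-m , valid-below , valid-rest ←
           push₂-sound (evalItem f (suc n) r (pair m c) (suc (π₁ d)) (π₁ (π₂ d)))
                       (positiveItem f n r c m (π₂ (π₂ d))) rest acc = positive , valid-rest
    where
    positive : ∀ j → j < suc m → ∃ λ v → decodeF f (suc n) r ⇓ (j ∷ toVec n c) ↦ suc v
    positive j j<1+m with m≤n⇒m<n∨m≡n (≤-pred j<1+m)
    ... | inj₁ j<m  = positiveItem-valid f n r c m (π₂ (π₂ d)) valid-below j j<m
    ... | inj₂ refl = π₁ d , evalItem-valid-∷ f n r m c (suc (π₁ d)) (π₁ (π₂ d)) valid-m

  checkLookup-sound : ∀ fs rest → Accepts k (checkLookup fs rest) → LookupHolds fs × AllValid rest
  checkLookup-sound (zero ∷ c ∷ i ∷ y ∷ []) rest acc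
    with y-check , valid-rest ← accept-sound ∣ y - π₁ c ∣ rest acc =
    sym (∣m-n∣≡0⇒m≡n y-check) , valid-rest
  checkLookup-sound (suc k′ ∷ c ∷ zero ∷ y ∷ []) rest acc
    with y-check , valid-rest ← accept-sound ∣ y - π₁ c ∣ rest acc =
    sym (∣m-n∣≡0⇒m≡n y-check) , valid-rest
  checkLookup-sound (suc k′ ∷ c ∷ suc i ∷ y ∷ []) rest acc
    with valid-tail , valid-rest ← push₁-sound (lookupItem k′ (π₂ c) i y) rest acc =
    lookupItem-valid k′ (π₂ c) i y valid-tail , valid-rest

  check-sound : ∀ t p rest → Accepts k (check t p rest) → Holds t p × AllValid rest
  check-sound 0                   p = checkEval-sound (toVec 6 p)
  check-sound 1                   p = checkEvals-sound (toVec 7 p)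
  check-sound 2                   p = checkPositive-sound (toVec 6 p)
  check-sound (suc (suc (suc _))) p = checkLookup-sound (toVec 4 p)

accepts-sound : ∀ k → Sound k
accepts-sound zero    .zero   refl ()
accepts-sound (suc k) zero    acc  ()
accepts-sound (suc k) (suc p) acc
  with valid , valid-rest ← check-sound {k} (accepts-sound k) (π₁ (π₁ p)) (π₂ (π₁ p)) (π₂ p) acc =
  λ { here → valid ; (there i∈rest) → valid-rest i∈rest }

verdict-sound : ∀ a z w e t → verdict a z w e t ≡ 0 → decode a ⇓ (z ∷ []) ↦ w
verdict-sound a z w e t rejected-by-0 =
  subst (decode a ⇓_↦ w) (toVec-fromVec (z ∷ []))
    (evalItem-valid a 1 a (fromVec (z ∷ [])) w e (proj₁ (allValid-cons item 0 (accepts-sound t _ acc))))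
  where
  item = evalItem a 1 a (fromVec (z ∷ [])) w e
  acc : Accepts t (initial a z w e)
  acc = trans (sym (iterate-is-fold (initial a z w e) step t)) (∣m-n∣≡0⇒m≡n rejected-by-0)

-- Completeness of the verifier

Dischargeable : ℕ → Set
Dischargeable i = ∃ λ k → ∀ rest → iterate step (suc (cons i rest)) k ≡ suc rest

iterate-+ : ∀ {A : Set} (f : A → A) x m n → iterate f x (m + n) ≡ iterate f (iterate f x m) n
iterate-+ f x zero    n = refl
iterate-+ f x (suc m) n = iterate-+ f (f x) m n

dischargeable-leaf : ∀ i → (∀ rest → step (suc (cons i rest)) ≡ suc rest) → Dischargeable i
dischargeable-leaf i pops = 1 , pops

dischargeable-unary : ∀ i A → (∀ rest → step (suc (cons i rest)) ≡ suc (cons A rest)) →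
                      Dischargeable A → Dischargeable i
dischargeable-unary i A replaces (k , A-done) =
  suc k , λ rest → trans (cong (λ s → iterate step s k) (replaces rest)) (A-done rest)

dischargeable-binary : ∀ i A B → (∀ rest → step (suc (cons i rest)) ≡ suc (cons A (cons B rest))) →
                       Dischargeable A → Dischargeable B → Dischargeable i
dischargeable-binary i A B replaces (k , A-done) (l , B-done) = suc (k + l) , λ rest → begin
  iterate step (step (suc (cons i rest))) (k + l)           ≡⟨ cong (λ s → iterate step s (k + l)) (replaces rest) ⟩
  iterate step (suc (cons A (cons B rest))) (k + l)          ≡⟨ iterate-+ step _ k l ⟩
  iterate step (iterate step (suc (cons A (cons B rest))) k) l ≡⟨ cong (λ s → iterate step s l) (A-done (cons B rest)) ⟩
  iterate step (suc (cons B rest)) l                          ≡⟨ B-done rest ⟩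
  suc rest                                                    ∎
  where open ≡-Reasoning

step-item : ∀ t p rest → step (suc (cons (pair t p) rest)) ≡ check t p rest
step-item t p rest
  rewrite π₁-pair (pair t p) rest | π₂-pair (pair t p) rest | π₁-pair t p | π₂-pair t p = refl

step-evalItem : ∀ f n x c y d rest →
                step (suc (cons (evalItem f n x c y d) rest)) ≡ checkEval (f ∷ n ∷ x ∷ c ∷ y ∷ d ∷ []) rest
step-evalItem f n x c y d rest =
  trans (step-item 0 (fromVec (f ∷ n ∷ x ∷ c ∷ y ∷ d ∷ [])) rest) (cong (λ v → checkEval v rest) (toVec-fromVec (f ∷ n ∷ x ∷ c ∷ y ∷ d ∷ [])))

step-evalsItem : ∀ f n m g c w d rest → step (suc (cons (evalsItem f n m g c w d) rest)) ≡
                 checkEvals (f ∷ n ∷ m ∷ g ∷ c ∷ w ∷ d ∷ []) rest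
step-evalsItem f n m g c w d rest =
  trans (step-item 1 (fromVec (f ∷ n ∷ m ∷ g ∷ c ∷ w ∷ d ∷ [])) rest) (cong (λ v → checkEvals v rest) (toVec-fromVec (f ∷ n ∷ m ∷ g ∷ c ∷ w ∷ d ∷ [])))

step-positiveItem : ∀ f n r c k d rest → step (suc (cons (positiveItem f n r c k d) rest)) ≡
                    checkPositive (f ∷ n ∷ r ∷ c ∷ k ∷ d ∷ []) rest
step-positiveItem f n r c k d rest =
  trans (step-item 2 (fromVec (f ∷ n ∷ r ∷ c ∷ k ∷ d ∷ [])) rest) (cong (λ v → checkPositive v rest) (toVec-fromVec (f ∷ n ∷ r ∷ c ∷ k ∷ d ∷ [])))

step-lookupItem : ∀ k c i y rest →
                  step (suc (cons (lookupItem k c i y) rest)) ≡ checkLookup (k ∷ c ∷ i ∷ y ∷ []) rest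
step-lookupItem k c i y rest =
  trans (step-item 3 (fromVec (k ∷ c ∷ i ∷ y ∷ [])) rest) (cong (λ v → checkLookup v rest) (toVec-fromVec (k ∷ c ∷ i ∷ y ∷ [])))

step-evalItem-term : ∀ f n x t r c y d rest → π₁ x ≡ t → π₂ x ≡ r →
                     step (suc (cons (evalItem (suc f) n x c y d) rest)) ≡ checkTerm f n x t r c y d rest
step-evalItem-term f n x t r c y d rest x-tag x-payload =
  trans (step-evalItem (suc f) n x c y d rest)
        (cong₂ (λ t r → checkTerm f n x t r c y d rest) x-tag x-payload)

lookup-dischargeable : ∀ k c i → Dischargeable (lookupItem k c i (lookup (toVec (suc k) c) (clampFin k i)))
lookup-dischargeable zero c i =
  dischargeable-leaf (lookupItem 0 c i (π₁ c)) λ rest →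
    trans (step-lookupItem 0 c i (π₁ c) rest) (cong (λ b → accept b rest) (∣n-n∣≡0 (π₁ c)))
lookup-dischargeable (suc k) c zero =
  dischargeable-leaf (lookupItem (suc k) c 0 (π₁ c)) λ rest →
    trans (step-lookupItem (suc k) c 0 (π₁ c) rest) (cong (λ b → accept b rest) (∣n-n∣≡0 (π₁ c)))
lookup-dischargeable (suc k) c (suc i) =
  dischargeable-unary (lookupItem (suc k) c (suc i) y) (lookupItem k (π₂ c) i y)
    (step-lookupItem (suc k) c (suc i) y) (lookup-dischargeable k (π₂ c) i)
  where y = lookup (toVec (suc k) (π₂ c)) (clampFin k i)

term-leaf : ∀ f n x t r c y → π₁ x ≡ t → π₂ x ≡ r →
            (∀ rest → checkTerm f n x t r c y 0 rest ≡ suc rest) →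
            ∃ λ d → Dischargeable (evalItem (suc f) n x c y d)
term-leaf f n x t r c y x-tag x-payload pops =
  0 , dischargeable-leaf (evalItem (suc f) n x c y 0)
        (λ rest → trans (step-evalItem-term f n x t r c y 0 rest x-tag x-payload) (pops rest))

mutual
  eval-dischargeable : ∀ f n x {v y} → decodeF f n x ⇓ v ↦ y → ∀ c → toVec n c ≡ v →
                       ∃ λ d → Dischargeable (evalItem f n x c y d)
  eval-dischargeable zero    n x Z⇓ c _   = 0 , dischargeable-leaf (evalItem 0 n x c 0 0) (step-evalItem 0 n x c 0 0)
  eval-dischargeable (suc f) n x D  c c≡v = term-dischargeable f n x (π₁ x) (π₂ x) refl refl D c c≡v

  term-dischargeable : ∀ f n x t r → π₁ x ≡ t → π₂ x ≡ r → ∀ {v y} → byTag f n t r ⇓ v ↦ y →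
                       ∀ c → toVec n c ≡ v → ∃ λ d → Dischargeable (evalItem (suc f) n x c y d)
  term-dischargeable f n x 0 r x-tag x-payload Z⇓ c _ =
    term-leaf f n x 0 r c 0 x-tag x-payload λ _ → refl
  term-dischargeable f 0 x 1 r x-tag x-payload Z⇓ c _ =
    term-leaf f 0 x 1 r c 0 x-tag x-payload λ _ → refl
  term-dischargeable f 1 x 1 r x-tag x-payload (S⇓ {a}) c c≡v =
    term-leaf f 1 x 1 r c (suc a) x-tag x-payload λ rest →
      trans (cong (λ b → accept ∣ a - b ∣ rest) (cong head c≡v)) (cong (λ b → accept b rest) (∣n-n∣≡0 a))
  term-dischargeable f (suc (suc n)) x 1 r x-tag x-payload Z⇓ c _ =
    term-leaf f (suc (suc n)) x 1 r c 0 x-tag x-payload λ _ → refl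
  term-dischargeable f 0 x 2 r x-tag x-payload Z⇓ c _ =
    term-leaf f 0 x 2 r c 0 x-tag x-payload λ _ → refl
  term-dischargeable f (suc k) x 2 r x-tag x-payload (P⇓ {v = v}) c c≡v =
    0 , dischargeable-unary (evalItem (suc f) (suc k) x c y 0) (lookupItem k c r y)
          (λ rest → step-evalItem-term f (suc k) x 2 r c y 0 rest x-tag x-payload)
          (subst (λ v → Dischargeable (lookupItem k c r (lookup v (clampFin k r)))) c≡v
                 (lookup-dischargeable k c r))
    where y = lookup v (clampFin k r)
  term-dischargeable f n x 3 r x-tag x-payload {y = y} (comp⇓ {ws = ws} gs⇓ f⇓) c c≡v
    with d₁ , f-done  ← eval-dischargeable f (π₁ r) (π₁ (π₂ r)) f⇓ (fromVec ws) (toVec-fromVec ws)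
       | d₂ , gs-done ← evals-dischargeable f n (π₁ r) (π₂ (π₂ r)) gs⇓ c c≡v =
    pair (fromVec ws) (pair d₁ d₂) ,
    dischargeable-binary item f-item gs-item replace f-done gs-done
    where
    item = evalItem (suc f) n x c y (pair (fromVec ws) (pair d₁ d₂))
    f-item = evalItem f (π₁ r) (π₁ (π₂ r)) (fromVec ws) y d₁
    gs-item = evalsItem f n (π₁ r) (π₂ (π₂ r)) c (fromVec ws) d₂
    replace : ∀ rest → step (suc (cons item rest)) ≡ suc (cons f-item (cons gs-item rest))
    replace rest =
      trans (step-evalItem-term f n x 3 r c y (pair (fromVec ws) (pair d₁ d₂)) rest x-tag x-payload)
            (pair-β₃ (λ W e₁ e₂ → suc (cons (evalItem f (π₁ r) (π₁ (π₂ r)) W y e₁)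
                                       (cons (evalsItem f n (π₁ r) (π₂ (π₂ r)) c W e₂) rest)))
                     (fromVec ws) d₁ d₂)
  term-dischargeable f 0 x 4 r x-tag x-payload Z⇓ c _ =
    term-leaf f 0 x 4 r c 0 x-tag x-payload λ _ → refl
  term-dischargeable f (suc k) x 4 r x-tag x-payload {y = y} (rec0⇓ g⇓) c c≡v
    with d , g-done ← eval-dischargeable f k (π₁ r) g⇓ (π₂ c) (cong tail c≡v) =
    d , dischargeable-unary item g-item replace g-done
    where
    item = evalItem (suc f) (suc k) x c y d
    g-item = evalItem f k (π₁ r) (π₂ c) y d
    replace : ∀ rest → step (suc (cons item rest)) ≡ suc (cons g-item rest)
    replace rest = trans (step-evalItem-term f (suc k) x 4 r c y d rest x-tag x-payload)
                         (cong (λ a → checkRec f (suc k) x r a (π₂ c) y d rest) (cong head c≡v))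
  term-dischargeable f (suc k) x 4 r x-tag x-payload {y = y}
                     (recS⇓ {v = v} {k = j} {r = z} rec⇓ h⇓) c c≡v
    with d₁ , rec-done ← term-dischargeable f (suc k) x 4 r x-tag x-payload rec⇓ (pair j (π₂ c))
                           (trans (toVec-pair k j (π₂ c)) (cong (j ∷_) (cong tail c≡v)))
       | d₂ , h-done ← eval-dischargeable f (suc (suc k)) (π₂ r) h⇓ (pair j (pair z (π₂ c)))
                         (trans (toVec-pair (suc k) j (pair z (π₂ c)))
                                (cong (j ∷_) (trans (toVec-pair k z (π₂ c)) (cong (z ∷_) (cong tail c≡v))))) =
    pair z (pair d₁ d₂) , dischargeable-binary item rec-item h-item replace rec-done h-done
    where
    item = evalItem (suc f) (suc k) x c y (pair z (pair d₁ d₂))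
    rec-item = evalItem (suc f) (suc k) x (pair j (π₂ c)) z d₁
    h-item = evalItem f (suc (suc k)) (π₂ r) (pair j (pair z (π₂ c))) y d₂
    replace : ∀ rest → step (suc (cons item rest)) ≡ suc (cons rec-item (cons h-item rest))
    replace rest =
      trans (step-evalItem-term f (suc k) x 4 r c y (pair z (pair d₁ d₂)) rest x-tag x-payload)
      (trans (cong (λ a → checkRec f (suc k) x r a (π₂ c) y (pair z (pair d₁ d₂)) rest) (cong head c≡v))
             (pair-β₃ (λ z′ e₁ e₂ → suc (cons (evalItem (suc f) (suc k) x (pair j (π₂ c)) z′ e₁)
                                        (cons (evalItem f (suc (suc k)) (π₂ r) (pair j (pair z′ (π₂ c))) y e₂)
                                              rest)))
                      z d₁ d₂))
  term-dischargeable f 0 x (suc (suc (suc (suc (suc t))))) r x-tag x-payload (mu⇓ zero⇓ below⇓) c c≡v =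
    mu-dischargeable f 0 x t r x-tag x-payload zero⇓ below⇓ c c≡v
  term-dischargeable f (suc n) x (suc (suc (suc (suc (suc t))))) r x-tag x-payload (mu⇓ zero⇓ below⇓) c c≡v =
    mu-dischargeable f (suc n) x t r x-tag x-payload zero⇓ below⇓ c c≡v

  mu-dischargeable : ∀ f n x t r → π₁ x ≡ suc (suc (suc (suc (suc t)))) → π₂ x ≡ r → ∀ {v y} →
                     decodeF f (suc n) r ⇓ (y ∷ v) ↦ 0 →
                     (∀ j → j < y → ∃ λ m → decodeF f (suc n) r ⇓ (j ∷ v) ↦ suc m) →
                     ∀ c → toVec n c ≡ v → ∃ λ d → Dischargeable (evalItem (suc f) n x c y d)
  mu-dischargeable f n x t r x-tag x-payload {y = y} zero⇓ below⇓ c c≡v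
    with d₁ , zero-done ← eval-dischargeable f (suc n) r zero⇓ (pair y c)
                            (trans (toVec-pair n y c) (cong (y ∷_) c≡v))
       | d₂ , below-done ← positive-dischargeable f n r c y below⇓ c≡v =
    pair d₁ d₂ , dischargeable-binary item zero-item below-item replace zero-done below-done
    where
    item = evalItem (suc f) n x c y (pair d₁ d₂)
    zero-item = evalItem f (suc n) r (pair y c) 0 d₁
    below-item = positiveItem f n r c y d₂
    replace : ∀ rest → step (suc (cons item rest)) ≡ suc (cons zero-item (cons below-item rest))
    replace rest =
      trans (step-evalItem-term f n x _ r c y (pair d₁ d₂) rest x-tag x-payload)
            (pair-β (λ e₁ e₂ → suc (cons (evalItem f (suc n) r (pair y c) 0 e₁)
                                     (cons (positiveItem f n r c y e₂) rest)))
                    d₁ d₂)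

  evals-dischargeable : ∀ f n m g {v ws} → decodeVec f n m g ⇓* v ↦ ws → ∀ c → toVec n c ≡ v →
                        ∃ λ d → Dischargeable (evalsItem f n m g c (fromVec ws) d)
  evals-dischargeable f n zero g []⇓ c _ =
    0 , dischargeable-leaf (evalsItem f n 0 g c 0 0) (step-evalsItem f n 0 g c 0 0)
  evals-dischargeable f n (suc m) g (∷⇓ {y = w} {ys = ws} g⇓ gs⇓) c c≡v
    with d₁ , g-done  ← eval-dischargeable f n (π₁ g) g⇓ c c≡v
       | d₂ , gs-done ← evals-dischargeable f n m (π₂ g) gs⇓ c c≡v =
    pair d₁ d₂ , dischargeable-binary item g-item gs-item replace g-done gs-done
    where
    item = evalsItem f n (suc m) g c (pair w (fromVec ws)) (pair d₁ d₂)
    g-item = evalItem f n (π₁ g) c w d₁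
    gs-item = evalsItem f n m (π₂ g) c (fromVec ws) d₂
    replace : ∀ rest → step (suc (cons item rest)) ≡ suc (cons g-item (cons gs-item rest))
    replace rest =
      trans (step-evalsItem f n (suc m) g c (pair w (fromVec ws)) (pair d₁ d₂) rest)
      (trans (pair-β (λ w′ W → suc (cons (evalItem f n (π₁ g) c w′ (π₁ (pair d₁ d₂)))
                                      (cons (evalsItem f n m (π₂ g) c W (π₂ (pair d₁ d₂))) rest)))
                     w (fromVec ws))
             (pair-β (λ e₁ e₂ → suc (cons (evalItem f n (π₁ g) c w e₁)
                                      (cons (evalsItem f n m (π₂ g) c (fromVec ws) e₂) rest)))
                     d₁ d₂))

  positive-dischargeable : ∀ f n r c k {v} → (∀ j → j < k → ∃ λ m → decodeF f (suc n) r ⇓ (j ∷ v) ↦ suc m) →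
                           toVec n c ≡ v → ∃ λ d → Dischargeable (positiveItem f n r c k d)
  positive-dischargeable f n r c zero below⇓ _ =
    0 , dischargeable-leaf (positiveItem f n r c 0 0) (step-positiveItem f n r c 0 0)
  positive-dischargeable f n r c (suc k) below⇓ c≡v
    with m , k⇓ ← below⇓ k (n<1+n k)
    with d₁ , k-done ← eval-dischargeable f (suc n) r k⇓ (pair k c) (trans (toVec-pair n k c) (cong (k ∷_) c≡v))
       | d₂ , below-done ← positive-dischargeable f n r c k (λ j j<k → below⇓ j (m<n⇒m<1+n j<k)) c≡v =
    pair m (pair d₁ d₂) , dischargeable-binary item k-item below-item replace k-done below-done
    where
    item = positiveItem f n r c (suc k) (pair m (pair d₁ d₂))
    k-item = evalItem f (suc n) r (pair k c) (suc m) d₁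
    below-item = positiveItem f n r c k d₂
    replace : ∀ rest → step (suc (cons item rest)) ≡ suc (cons k-item (cons below-item rest))
    replace rest =
      trans (step-positiveItem f n r c (suc k) (pair m (pair d₁ d₂)) rest)
            (pair-β₃ (λ m′ e₁ e₂ → suc (cons (evalItem f (suc n) r (pair k c) (suc m′) e₁)
                                        (cons (positiveItem f n r c k e₂) rest)))
                     m d₁ d₂)

verdict-complete : ∀ a z w → decode a ⇓ (z ∷ []) ↦ w → ∃ λ e → ∃ λ t → verdict a z w e t ≡ 0
verdict-complete a z w a⇓
  with e , t , done ← eval-dischargeable a 1 a a⇓ (fromVec (z ∷ [])) (toVec-fromVec (z ∷ [])) =
  e , t , cong (λ s → ∣ s - 1 ∣) (trans (iterate-is-fold (initial a z w e) step t) (done 0))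

-- Gödel numbers of terms

encode : ∀ {n} → PR n → ℕ
encodeVec : ∀ {n m} → Vec (PR n) m → ℕ
encode Z                   = 0
encode S                   = pair 1 0
encode (P i)               = pair 2 (toℕ i)
encode (comp {m = m} f gs) = pair 3 (pair m (pair (encode f) (encodeVec gs)))
encode (rec g h)           = pair 4 (pair (encode g) (encode h))
encode (mu f)              = pair 5 (encode f)
encodeVec []       = 0
encodeVec (g ∷ gs) = pair (encode g) (encodeVec gs)

n≤triangle : ∀ n → n ≤ triangle n
n≤triangle zero    = z≤n
n≤triangle (suc n) = m≤n+m (suc n) (triangle n)

m≤pair : ∀ m n → m ≤ pair m n
m≤pair m n = m≤n+m m (triangle (m + n))

n≤pair : ∀ m n → n ≤ pair m n
n≤pair m n = ≤-trans (m≤n+m n m) (≤-trans (n≤triangle (m + n)) (m≤m+n (triangle (m + n)) m))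

n<pair-suc : ∀ t r → r < pair (suc t) r
n<pair-suc t r = ≤-trans (s≤s (m≤n+m r t))
                  (≤-trans (m≤n+m (suc (t + r)) (triangle (t + r))) (m≤m+n _ (suc t)))

fuel-decreases : ∀ t r fuel → pair (suc t) r ≤ fuel → ∃ λ f → fuel ≡ suc f × r ≤ f
fuel-decreases t r (suc f) p≤fuel = f , refl , ≤-pred (≤-trans (n<pair-suc t r) p≤fuel)
fuel-decreases t r zero    p≤0 with () ← ≤-trans (n<pair-suc t r) p≤0

clampFin-toℕ : ∀ k (i : Fin (suc k)) → clampFin k (toℕ i) ≡ i
clampFin-toℕ zero    zero    = refl
clampFin-toℕ (suc k) zero    = refl
clampFin-toℕ (suc k) (suc i) = cong suc (clampFin-toℕ k i)

decodeF-pair : ∀ f n t r → decodeF (suc f) n (pair t r) ≡ byTag f n t r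
decodeF-pair f n = pair-β (byTag f n)

mutual
  decodeF-encode : ∀ {n} (t : PR n) fuel → encode t ≤ fuel → decodeF fuel n (encode t) ≡ t
  decodeF-encode Z zero    _ = refl
  decodeF-encode Z (suc _) _ = refl
  decodeF-encode S (suc _) _ = refl
  decodeF-encode {suc k} (P i) fuel code≤fuel
    with f , refl , _ ← fuel-decreases 1 (toℕ i) fuel code≤fuel =
    trans (decodeF-pair f (suc k) 2 (toℕ i)) (cong P (clampFin-toℕ k i))
  decodeF-encode {n} (comp {m = m} g hs) fuel code≤fuel
    with f , refl , r≤f ← fuel-decreases 2 (pair m (pair (encode g) (encodeVec hs))) fuel code≤fuel =
    trans (decodeF-pair f n 3 (pair m (pair (encode g) (encodeVec hs))))
      (trans (pair-β₃ (λ m′ g′ hs′ → comp (decodeF f m′ g′) (decodeVec f n m′ hs′)) m (encode g) (encodeVec hs))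
             (cong₂ comp (decodeF-encode g f (≤-trans (m≤pair (encode g) _) (≤-trans (n≤pair m _) r≤f)))
                         (decodeVec-encode hs f (≤-trans (n≤pair (encode g) _) (≤-trans (n≤pair m _) r≤f)))))
  decodeF-encode {suc n} (rec g h) fuel code≤fuel
    with f , refl , r≤f ← fuel-decreases 3 (pair (encode g) (encode h)) fuel code≤fuel =
    trans (decodeF-pair f (suc n) 4 (pair (encode g) (encode h)))
      (trans (pair-β (λ g′ h′ → rec (decodeF f n g′) (decodeF f (suc (suc n)) h′)) (encode g) (encode h))
             (cong₂ rec (decodeF-encode g f (≤-trans (m≤pair (encode g) (encode h)) r≤f))
                        (decodeF-encode h f (≤-trans (n≤pair (encode g) (encode h)) r≤f))))
  decodeF-encode {n} (mu g) fuel code≤fuel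
    with f , refl , r≤f ← fuel-decreases 4 (encode g) fuel code≤fuel =
    trans (decodeF-pair f n 5 (encode g))
          (trans (byTag-mu f n 0 (encode g)) (cong mu (decodeF-encode g f r≤f)))

  decodeVec-encode : ∀ {n m} (gs : Vec (PR n) m) fuel → encodeVec gs ≤ fuel →
                     decodeVec fuel n m (encodeVec gs) ≡ gs
  decodeVec-encode []       fuel _ = refl
  decodeVec-encode (g ∷ gs) fuel code≤fuel =
    trans (pair-β (λ g′ gs′ → decodeF fuel _ g′ ∷ decodeVec fuel _ _ gs′) (encode g) (encodeVec gs))
          (cong₂ _∷_ (decodeF-encode g fuel (≤-trans (m≤pair (encode g) (encodeVec gs)) code≤fuel))
                     (decodeVec-encode gs fuel (≤-trans (n≤pair (encode g) (encodeVec gs)) code≤fuel)))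

mutual
  ⇓-deterministic : ∀ {n} {t : PR n} {v y y′} → t ⇓ v ↦ y → t ⇓ v ↦ y′ → y ≡ y′
  ⇓-deterministic Z⇓ Z⇓ = refl
  ⇓-deterministic S⇓ S⇓ = refl
  ⇓-deterministic P⇓ P⇓ = refl
  ⇓-deterministic (comp⇓ gs⇓ f⇓) (comp⇓ gs⇓′ f⇓′)
    with refl ← ⇓*-deterministic gs⇓ gs⇓′ = ⇓-deterministic f⇓ f⇓′
  ⇓-deterministic (rec0⇓ g⇓) (rec0⇓ g⇓′) = ⇓-deterministic g⇓ g⇓′
  ⇓-deterministic (recS⇓ rec⇓ h⇓) (recS⇓ rec⇓′ h⇓′)
    with refl ← ⇓-deterministic rec⇓ rec⇓′ = ⇓-deterministic h⇓ h⇓′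
  ⇓-deterministic (mu⇓ {k = k} zero⇓ below⇓) (mu⇓ {k = k′} zero⇓′ below⇓′) with <-cmp k k′
  ... | tri≈ _ k≡k′ _ = k≡k′
  ... | tri< k<k′ _ _ with _ , positive ← below⇓′ k k<k′ = ⊥-elim (0≢1+n (⇓-deterministic zero⇓ positive))
  ... | tri> _ _ k′<k with _ , positive ← below⇓ k′ k′<k = ⊥-elim (0≢1+n (⇓-deterministic zero⇓′ positive))

  ⇓*-deterministic : ∀ {n m} {ts : Vec (PR n) m} {v ys ys′} → ts ⇓* v ↦ ys → ts ⇓* v ↦ ys′ → ys ≡ ys′
  ⇓*-deterministic []⇓         []⇓           = refl
  ⇓*-deterministic (∷⇓ t⇓ ts⇓) (∷⇓ t⇓′ ts⇓′) = cong₂ _∷_ (⇓-deterministic t⇓ t⇓′) (⇓*-deterministic ts⇓ ts⇓′)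

-- The Σ⁰₃ form of SI

boundedBy≡0⇒ : ∀ x a z y d s w e t → boundedBy x a (z ∷ y ∷ d ∷ s ∷ []) (w ∷ e ∷ t ∷ []) ≡ 0 →
               verdict a z w e t ≡ 0 × (verdict x z y d s ≡ 0 → y ≤ w)
boundedBy≡0⇒ x a z y d s w e t bounded with verdict a z w e t | verdict x z y d s
... | zero | zero  = refl , λ _ → m∸n≡0⇒m≤n bounded
... | zero | suc _ = refl , λ ()

boundedBy≡0⇐ : ∀ x a z y d s w e t → verdict a z w e t ≡ 0 → (verdict x z y d s ≡ 0 → y ≤ w) →
               boundedBy x a (z ∷ y ∷ d ∷ s ∷ []) (w ∷ e ∷ t ∷ []) ≡ 0
boundedBy≡0⇐ x a z y d s w e t a-accepts bound with verdict a z w e t | verdict x z y d s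
boundedBy≡0⇐ x a z y d s w e t refl bound | zero | zero  = m≤n⇒m∸n≡0 (bound refl)
boundedBy≡0⇐ x a z y d s w e t refl bound | zero | suc _ = refl

χ-fromVecʳ : ∀ x a b (w : Vec ℕ 3) → χ (x ∷ a ∷ b ∷ fromVec w ∷ []) ≡ boundedBy x a (toVec 4 b) w
χ-fromVecʳ x a b w = cong (boundedBy x a (toVec 4 b)) (toVec-fromVec w)

χ-fromVecˡ : ∀ x a (u : Vec ℕ 4) c → χ (x ∷ a ∷ fromVec u ∷ c ∷ []) ≡ boundedBy x a u (toVec 3 c)
χ-fromVecˡ x a u c = cong (λ u → boundedBy x a u (toVec 3 c)) (toVec-fromVec u)

SI⇒Σ⁰₃-form : ∀ x → SI x → ∃ λ a → ∀ b → ∃ λ c → χ (x ∷ a ∷ b ∷ c ∷ []) ≡ 0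
SI⇒Σ⁰₃-form x (F , (p , p⇓) , F-bounds) = a , λ b → fromVec (witness (π₁ b)) , bounded b
  where
  a = encode p
  a⇓ : ∀ z → decode a ⇓ (z ∷ []) ↦ F z
  a⇓ z = subst (_⇓ (z ∷ []) ↦ F z) (sym (decodeF-encode p a ≤-refl)) (p⇓ (z ∷ []))
  a-run : ∀ z → ∃ λ e → ∃ λ t → verdict a z (F z) e t ≡ 0
  a-run z = verdict-complete a z (F z) (a⇓ z)
  witness : ℕ → Vec ℕ 3
  witness z = F z ∷ proj₁ (a-run z) ∷ proj₁ (proj₂ (a-run z)) ∷ []
  bounded : ∀ b → χ (x ∷ a ∷ b ∷ fromVec (witness (π₁ b)) ∷ []) ≡ 0
  bounded b = trans (χ-fromVecʳ x a b (witness z))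
    (boundedBy≡0⇐ x a z y d s (F z) e t (proj₂ (proj₂ (a-run z)))
                  (λ x-accepts → F-bounds z y (verdict-sound x z y d s x-accepts)))
    where
    z = π₁ b
    y = π₁ (π₂ b)
    d = π₁ (π₂ (π₂ b))
    s = π₁ (π₂ (π₂ (π₂ b)))
    e = proj₁ (a-run z)
    t = proj₁ (proj₂ (a-run z))

Σ⁰₃-form⇒SI : ∀ x → (∃ λ a → ∀ b → ∃ λ c → χ (x ∷ a ∷ b ∷ c ∷ []) ≡ 0) → SI x
Σ⁰₃-form⇒SI x (a , bounded) = F , (decode a , λ { (z ∷ []) → a⇓ z }) , F-bounds
  where
  a-bounds : ∀ z y d s → ∃ λ w → ∃ λ e → ∃ λ t →
             verdict a z w e t ≡ 0 × (verdict x z y d s ≡ 0 → y ≤ w)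
  a-bounds z y d s with c , χ≡0 ← bounded (fromVec (z ∷ y ∷ d ∷ s ∷ [])) =
    w , e , t , boundedBy≡0⇒ x a z y d s w e t (trans (sym (χ-fromVecˡ x a (z ∷ y ∷ d ∷ s ∷ []) c)) χ≡0)
    where
    w = π₁ c
    e = π₁ (π₂ c)
    t = π₁ (π₂ (π₂ c))
  -- Any (y, d, s) would do here: the first conjunct alone makes w the value of program a at z.
  F : ℕ → ℕ
  F z = proj₁ (a-bounds z 0 0 0)
  a⇓ : ∀ z → decode a ⇓ (z ∷ []) ↦ F z
  a⇓ z = verdict-sound a z w e t a-accepts
    where
    w e t : ℕ
    w = proj₁ (a-bounds z 0 0 0)
    e = proj₁ (proj₂ (a-bounds z 0 0 0))
    t = proj₁ (proj₂ (proj₂ (a-bounds z 0 0 0)))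
    a-accepts : verdict a z w e t ≡ 0
    a-accepts = proj₁ (proj₂ (proj₂ (proj₂ (a-bounds z 0 0 0))))
  F-bounds : ∀ z y → φ x ⟨ z ⟩↦ y → y ≤ F z
  F-bounds z y x⇓
    with d , s , x-accepts ← verdict-complete x z y x⇓
    with w , e , t , a-accepts , bound ← a-bounds z y d s =
    subst (y ≤_) (⇓-deterministic (verdict-sound a z w e t a-accepts) (a⇓ z)) (bound x-accepts)

theorem5 : Σ⁰₃ SI
theorem5 = χ , χ-computable , λ x → mk⇔ (SI⇒Σ⁰₃-form x) (Σ⁰₃-form⇒SI x)
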